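{- Let $l\in\omega$ and let $u\in 2^{<\omega}$ be $l$-placed with $|u|\geq 2$. Write $u^l$ for $u^{l(u)}$. (a) If $u^-$ is $l$-placed, then $\varepsilon(u^-)=\varepsilon(u)$; if moreover $(u^l)^-$ is $l$-placed, then $(u^l)^-=(u^-)^l$. (b) $u^{ -l}$ is $l$-placed if and only if $(u^l)^{ -l}$ is $l$-placed; in this case $\varepsilon(u^{ -l})=\varepsilon(u)$ and $(u^l)^{ -l}=(u^{ -l})^l$. (c) If $u^-$ or $(u^l)^-$ is $(<l)$-placed, then $u^-=u^{ -l}=(u^l)^-=(u^l)^{ -l}$. (d) If $u^-$ or $(u^l)^-$ is $(>l)$-placed, then exactly one of these two sequences is $(>l)$-placed and the other one is $l$-placed. If $u^-$ is $(>l)$-placed, then $u^{ -l}=((u^l)^-)^l$ and $\varepsilon(u^{ -l})=\varepsilon(u)$; if $(u^l)^-$ is $(>l)$-placed, then $u^{ -l}=u^-$ and $\varepsilon((u^l)^{ -l})=\varepsilon(u^l)$.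
   Context: $\langle n,p\rangle:=(\sum_{k\leq n+p}k)+p$, a bijection $\omega^2\to\omega$ with inverse $q\mapsto((q)_0,(q)_1)$; for $u\in 2^{<\omega}$, $(u)_n(p):=u(\langle n,p\rangle)$ when $\langle n,p\rangle<|u|$. $t_n:=\psi(n)0^{n-|\psi(n)|}$ where $\psi:=(i\circ I)^{ -1}$, $I(\emptyset)=1$, $I(s)=\prod_{j<|s|}p_j^{s(j)+1}$ ($p_j$ the $j$-th prime), $i$ the increasing bijection $I[\omega^{<\omega}]\to\omega$. $s_n:=\phi(n)0^{n-|\phi(n)|}$ where $\phi$ is the natural enumeration of $2^{<\omega}$ by increasing length ($\phi(0)=\emptyset,\phi(1)=\langle0\rangle,\phi(2)=\langle1\rangle,\dots$). For $u\neq\emptyset$, $u^m:=u|(|u|-1)$. $u$ is placed if $u\neq\emptyset$, $(u)_i\subseteq s_{t_{(|u^m|)_0}(i)}10^\infty$ for all $i<(|u^m|)_0$, and $u(|u^m|)=1$ if $(|u^m|)_1>0$. For placed $u$: $l(u):=(|u^m|)_0$; $u^{l(u)}\in 2^{|u|}$ is defined by $u^{l(u)}(m)=u(m)$ for $m\neq\langle l(u),0\rangle$ and $u^{l(u)}(\langle l(u),0\rangle)=1-u(\langle l(u),0\rangle)$; $\varepsilon(u):=u(\langle l(u),0\rangle)$. $u$ is $l$-placed if it is placed with $l(u)=l$; $(\leq l)$-placed (resp. $(<l)$-, $(>l)$-placed) if it is $l'$-placed for some $l'\leq l$ (resp. $l'<l$, $l'>l$). For $u\in 2^{<\omega}$: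 $u^-:=\emptyset$ if $|u|\leq1$ and $u^-:=u|\max\{k<|u|: u|k\text{ placed}\}$ if $|u|\geq2$; for $l\in\omega$, $u^{ -l}:=\emptyset$ if $|u|\leq 1$ and $u^{ -l}:=u|\max\{k<|u|: u|k\text{ is }(\leq l)\text{ -placed}\}$ if $|u|\geq 2$ (these maxima exist since $\langle\eta\rangle$ is $0$-placed for $\eta\in 2$). -}

module Defs where

open import Data.Nat using (ℕ; zero; suc; _+_; _*_; _∸_; _^_; _≤_; _<_; _≤?_; _<?_; _≡ᵇ_)
open import Data.Nat.DivMod using (_/_)
open import Data.Nat.Divisibility using (_∣?_)
open import Data.Nat.Primality using (Prime; prime?)
open import Data.Nat using (_!)
open import Data.Nat.Binary.Base using (ℕᵇ; zero; 2[1+_]; 1+[2_]; fromℕ)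
open import Data.Bool using (Bool; true; false; not; if_then_else_)
import Data.Bool as B
open import Data.List using (List; []; _∷_; _++_; [_]; length; replicate; take; product; upTo; map)
open import Data.Fin using (Fin; toℕ)
open import Data.Fin.Properties using (all?)
open import Data.Product using (Σ; _×_; _,_; proj₁; proj₂)
open import Data.Empty using (⊥)
open import Relation.Nullary using (Dec; yes; no; does)
open import Relation.Nullary.Decidable using (_×-dec_; _→-dec_)
open import Relation.Binary.PropositionalEquality using (_≡_)

-- value of a finite binary sequence at position n (false outside the
-- domain; only ever used inside the domain, or for reading an
-- eventually-zero infinite sequence given by its non-zero prefix)
at : List Bool → ℕ → Bool
at []       _       = false
at (x ∷ xs) zero    = x
at (x ∷ xs) (suc n) = at xs n

atℕ : List ℕ → ℕ → ℕ
atℕ []       _       = 0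
atℕ (x ∷ xs) zero    = x
atℕ (x ∷ xs) (suc n) = atℕ xs n

searchFrom : (ℕ → Bool) → ℕ → ℕ → ℕ
searchFrom P x zero       = x
searchFrom P x (suc fuel) = if P x then x else searchFrom P (suc x) fuel

-- largest k < n with P k (0 if none)
maxBelow : (ℕ → Bool) → ℕ → ℕ
maxBelow P zero    = 0
maxBelow P (suc n) = if P n then n else maxBelow P n

tri : ℕ → ℕ
tri zero    = 0
tri (suc m) = suc m + tri m

⟨_,_⟩ : ℕ → ℕ → ℕ
⟨ n , p ⟩ = tri (n + p) + p

-- inverse q ↦ ((q)₀ , (q)₁): enumerates the diagonals in the order
-- ⟨d,0⟩ < ⟨d-1,1⟩ < … < ⟨0,d⟩ < ⟨d+1,0⟩ < …
unpair : ℕ → ℕ × ℕ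
unpair zero = 0 , 0
unpair (suc q) with unpair q
... | zero  , p = suc p , 0
... | suc n , p = n , suc p

isPrimeᵇ : ℕ → Bool
isPrimeᵇ n = does (prime? n)

-- p_0 = 2, p_{j+1} = least prime > p_j  (one exists below p_j ! + 2)
nthPrime : ℕ → ℕ
nthPrime zero    = 2
nthPrime (suc j) = searchFrom isPrimeᵇ (suc (nthPrime j)) (suc (nthPrime j !))

Iaux : ℕ → List ℕ → ℕ
Iaux j []       = 1
Iaux j (e ∷ es) = nthPrime j ^ suc e * Iaux (suc j) es

I : List ℕ → ℕ
I = Iaux 0

multAux : ℕ → ℕ → ℕ → ℕ
multAux zero     p       m = 0
multAux (suc f)  zero    m = 0
multAux (suc f)  (suc p) m with m
... | zero  = 0
... | suc m' = if does (suc p ∣? suc m') then suc (multAux f (suc p) (suc m' / suc p)) else 0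

mult : ℕ → ℕ → ℕ
mult p m = multAux m p m

-- candidate preimage of m under I: exponents (minus one) of the
-- consecutive primes p_0, p_1, … dividing m
decodeAux : ℕ → ℕ → ℕ → List ℕ
decodeAux zero    j m = []
decodeAux (suc f) j m =
  if does (nthPrime j ∣? m) then (mult (nthPrime j) m ∸ 1) ∷ decodeAux f (suc j) m else []

decode : ℕ → List ℕ
decode m = decodeAux m 0 m

inImᵇ : ℕ → Bool
inImᵇ m = I (decode m) ≡ᵇ m

-- i⁻¹ : n ↦ n-th element (in increasing order) of I[ω^{<ω}]
-- (a power of 2, which lies in the image, exists in (x , 2x])
enumIm : ℕ → ℕ
enumIm zero    = 1
enumIm (suc n) = searchFrom inImᵇ (suc (enumIm n)) (enumIm n)

ψ : ℕ → List ℕ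
ψ n = decode (enumIm n)

t : ℕ → List ℕ
t n = ψ n ++ replicate (n ∸ length (ψ n)) 0

-- φ : natural enumeration of 2^{<ω} (by length, then lexicographic);
-- this is bijective base-2 numeration (digit 1 ↦ 0, digit 2 ↦ 1)

φᵇ : ℕᵇ → List Bool
φᵇ zero      = []
φᵇ 2[1+ x ]  = φᵇ x ++ [ true ]
φᵇ 1+[2 x ]  = φᵇ x ++ [ false ]

φ : ℕ → List Bool
φ n = φᵇ (fromℕ n)

s : ℕ → List Bool
s n = φ n ++ replicate (n ∸ length (φ n)) false

s10∞ : ℕ → ℕ → Bool
s10∞ n p = at (s n ++ [ true ]) p

lenm : List Bool → ℕ
lenm u = length u ∸ 1

lOf : List Bool → ℕ
lOf u = proj₁ (unpair (lenm u))

-- (u)_i ⊆ s_{t_{l}(i)} 1 0^∞, written out: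
-- (u)_i(p) = u(⟨i,p⟩) for ⟨i,p⟩ < |u| (note p ≤ ⟨i,p⟩ so p < |u|)
ColOK : (u : List Bool) (l : ℕ) → Fin l → Set
ColOK u l i = (p : Fin (length u)) → ⟨ toℕ i , toℕ p ⟩ < length u →
              at u ⟨ toℕ i , toℕ p ⟩ ≡ s10∞ (atℕ (t l) (toℕ i)) (toℕ p)

Placed : List Bool → Set
Placed []       = ⊥
Placed (x ∷ xs) =
  ((i : Fin (lOf u)) → ColOK u (lOf u) i) ×
  (0 < proj₂ (unpair (lenm u)) → at u (lenm u) ≡ true)
  where u = x ∷ xs

Placed? : (u : List Bool) → Dec (Placed u)
Placed? []       = no (λ ())
Placed? (x ∷ xs) =
  all? (λ i → all? (λ p → (⟨ toℕ i , toℕ p ⟩ <? length u) →-dec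
      (at u ⟨ toℕ i , toℕ p ⟩ B.≟ s10∞ (atℕ (t (lOf u)) (toℕ i)) (toℕ p)))) ×-dec
  ((0 <? proj₂ (unpair (lenm u))) →-dec (at u (lenm u) B.≟ true))
  where u = x ∷ xs

LPlaced : ℕ → List Bool → Set
LPlaced l u = Placed u × lOf u ≡ l

LeqPlaced : ℕ → List Bool → Set
LeqPlaced l u = Placed u × lOf u ≤ l

LtPlaced : ℕ → List Bool → Set
LtPlaced l u = Placed u × lOf u < l

GtPlaced : ℕ → List Bool → Set
GtPlaced l u = Placed u × l < lOf u

LeqPlaced? : (l : ℕ) (u : List Bool) → Dec (LeqPlaced l u)
LeqPlaced? l u = Placed? u ×-dec (lOf u ≤? l)

flipAt : List Bool → ℕ → List Bool
flipAt []       _       = []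
flipAt (x ∷ xs) zero    = not x ∷ xs
flipAt (x ∷ xs) (suc n) = x ∷ flipAt xs n

sup : List Bool → List Bool
sup u = flipAt u ⟨ lOf u , 0 ⟩

ε : List Bool → Bool
ε u = at u ⟨ lOf u , 0 ⟩

minus : List Bool → List Bool
minus []           = []
minus (x ∷ [])     = []
minus (x ∷ y ∷ r)  = take (maxBelow (λ k → does (Placed? (take k u))) (length u)) u
  where u = x ∷ y ∷ r

minusL : ℕ → List Bool → List Bool
minusL l []           = []
minusL l (x ∷ [])     = []
minusL l (x ∷ y ∷ r)  = take (maxBelow (λ k → does (LeqPlaced? l (take k u))) (length u)) u
  where u = x ∷ y ∷ r

-- Put n₀ = ⟨l,0⟩; u^l is u with the bit at n₀ flipped.  Two facts about placed sequences v
-- drive the proof.  First, placedness reads only the rows i < l(v) and the last entry of v, so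
-- for l(v) ≤ l it is blind to the bit at n₀ (flip-placed): u and u^l have the same (≤ l)-placed
-- prefixes, (u^l)^{-l} is u^{-l} flipped at n₀, and (a), (b) follow.  Second, row i < l(v) of v
-- reads s_c 1 0^∞ with i + c < l(v) (t-bound, a counting argument on prime exponents), so v
-- shows that row up to its final 1.  If n₀ is the last position of u, u and u^l share all
-- proper prefixes and none of them is (> l)-placed, which settles (c) and (d).  Otherwise the
-- prefix ending at n₀ is l-placed, and the row patterns forbid a (< l)-placed u^-
-- (no-lower-prefix) and forbid u^- and (u^l)^- from being both (> l)-placed (no-two-higher).
module Submission where

open import Defs
open import Data.Nat
open import Data.Nat.Properties
open import Data.Nat.Divisibility
  using (_∣_; divides; _∣?_; 1∣_; ∣⇒≤; ∣1⇒≡1; ∣m+n∣m⇒∣n; m∣m*n; *-monoʳ-∣; m≤n⇒m!∣n!; ∣-trans)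
open import Data.Nat.DivMod using (m*[n/m]≡n)
open import Data.Nat.Primality
  using (Prime; prime?; euclidsLemma; prime⇒irreducible; prime⇒nonTrivial; prime[2])
open import Data.Nat.Primality.Factorisation using (factorise)
import Data.Nat.Binary.Base as Bin
import Data.Nat.Binary.Properties as Bin
open import Data.Bool using (Bool; true; false; not; if_then_else_)
open import Data.Bool.Properties using (not-involutive; not-¬)
open import Function using (_∘_; id)
open import Function.Bundles using (_⇔_; mk⇔; Equivalence)
open import Data.Fin using (toℕ; fromℕ<)
open import Data.Fin.Properties using (toℕ<n; toℕ-fromℕ<)
open import Data.List using (List; []; _∷_; _++_; [_]; length; replicate; take)
open import Data.Nat.ListAction using (product)
open import Data.List.Properties using (length-++; length-replicate; length-take)
open import Data.List.Relation.Unary.All using (_∷_)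
open import Data.Product using (Σ; _×_; _,_; proj₁; proj₂)
open import Data.Sum using (_⊎_; inj₁; inj₂; [_,_]′)
open import Data.Empty using (⊥; ⊥-elim)
open import Relation.Nullary using (¬_; Dec; yes; no; does)
open import Relation.Nullary.Decidable using (dec-true)
open import Relation.Binary.PropositionalEquality hiding ([_])
open import Relation.Binary.Definitions using (Tri; tri<; tri≈; tri>)

tri-mono : ∀ {a b} → a ≤ b → tri a ≤ tri b
tri-mono {zero}  {b}     _         = z≤n
tri-mono {suc a} {suc b} (s≤s a≤b) = +-mono-≤ (s≤s a≤b) (tri-mono a≤b)

pair-<-diagonal : ∀ a b c d → a + b < c + d → ⟨ a , b ⟩ < ⟨ c , d ⟩
pair-<-diagonal a b c d a+b<c+d = begin-strict
  tri (a + b) + b         ≤⟨ +-monoʳ-≤ (tri (a + b)) (m≤n+m b a) ⟩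
  tri (a + b) + (a + b)   <⟨ n<1+n _ ⟩
  suc (tri (a + b) + (a + b)) ≡⟨ cong suc (+-comm (tri (a + b)) (a + b)) ⟩
  tri (suc (a + b))       ≤⟨ tri-mono a+b<c+d ⟩
  tri (c + d)             ≤⟨ m≤m+n (tri (c + d)) d ⟩
  ⟨ c , d ⟩               ∎
  where open ≤-Reasoning

pair-injective : ∀ a b c d → ⟨ a , b ⟩ ≡ ⟨ c , d ⟩ → a ≡ c × b ≡ d
pair-injective a b c d eq with <-cmp (a + b) (c + d)
... | tri< lt _ _ = ⊥-elim (<-irrefl eq (pair-<-diagonal a b c d lt))
... | tri> _ _ gt = ⊥-elim (<-irrefl (sym eq) (pair-<-diagonal c d a b gt))
... | tri≈ _ same _ = a≡c , b≡d
  where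
  b≡d : b ≡ d
  b≡d = +-cancelˡ-≡ (tri (a + b)) b d (trans eq (cong (λ z → tri z + d) (sym same)))
  a≡c : a ≡ c
  a≡c = +-cancelʳ-≡ b a c (trans same (cong (c +_) (sym b≡d)))

pair-unpair : ∀ q → ⟨ proj₁ (unpair q) , proj₂ (unpair q) ⟩ ≡ q
pair-unpair zero = refl
pair-unpair (suc q) with unpair q | pair-unpair q
... | zero , p | eq = begin
  tri (suc p + 0) + 0 ≡⟨ +-identityʳ _ ⟩
  tri (suc p + 0)     ≡⟨ cong tri (+-identityʳ (suc p)) ⟩
  suc p + tri p       ≡⟨ cong suc (+-comm p (tri p)) ⟩
  suc (tri p + p)     ≡⟨ cong suc eq ⟩
  suc q               ∎
  where open ≡-Reasoning
... | suc n , p | eq = begin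
  tri (n + suc p) + suc p   ≡⟨ cong (λ z → tri z + suc p) (+-suc n p) ⟩
  tri (suc n + p) + suc p   ≡⟨ +-suc _ p ⟩
  suc (tri (suc n + p) + p) ≡⟨ cong suc eq ⟩
  suc q                     ∎
  where open ≡-Reasoning

unpair-pair : ∀ a b → unpair ⟨ a , b ⟩ ≡ (a , b)
unpair-pair a b with pair-injective _ _ a b (pair-unpair ⟨ a , b ⟩)
... | e₁ , e₂ = cong₂ _,_ e₁ e₂

pair-row-start : ∀ a b → ⟨ a , 0 ⟩ ≤ ⟨ a , b ⟩
pair-row-start a b = +-mono-≤ (tri-mono (+-monoʳ-≤ a z≤n)) z≤n

p≤pair : ∀ i p → p ≤ ⟨ i , p ⟩
p≤pair i p = m≤n+m p (tri (i + p))

at-++ʳ : ∀ (xs ys : List Bool) k → at (xs ++ ys) (length xs + k) ≡ at ys k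
at-++ʳ []       ys k = refl
at-++ʳ (x ∷ xs) ys k = at-++ʳ xs ys k

length-φᵇ : ∀ x → length (φᵇ x) ≤ Bin.toℕ x
length-φᵇ Bin.zero = z≤n
length-φᵇ Bin.2[1+ x ] = begin
  length (φᵇ x ++ [ true ]) ≡⟨ length-++ (φᵇ x) ⟩
  length (φᵇ x) + 1         ≡⟨ +-comm _ 1 ⟩
  suc (length (φᵇ x))       ≤⟨ s≤s (length-φᵇ x) ⟩
  suc (Bin.toℕ x)           ≤⟨ m≤m+n (suc (Bin.toℕ x)) _ ⟩
  suc (Bin.toℕ x) + (suc (Bin.toℕ x) + 0) ∎
  where open ≤-Reasoning
length-φᵇ Bin.1+[2 x ] = begin
  length (φᵇ x ++ [ false ]) ≡⟨ length-++ (φᵇ x) ⟩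
  length (φᵇ x) + 1          ≡⟨ +-comm _ 1 ⟩
  suc (length (φᵇ x))        ≤⟨ s≤s (length-φᵇ x) ⟩
  suc (Bin.toℕ x)            ≤⟨ s≤s (m≤m+n (Bin.toℕ x) _) ⟩
  suc (Bin.toℕ x + (Bin.toℕ x + 0)) ∎
  where open ≤-Reasoning

length-s : ∀ n → length (s n) ≡ n
length-s n = begin
  length (φ n ++ replicate (n ∸ length (φ n)) false)  ≡⟨ length-++ (φ n) ⟩
  length (φ n) + length (replicate (n ∸ length (φ n)) false)
      ≡⟨ cong (length (φ n) +_) (length-replicate (n ∸ length (φ n))) ⟩
  length (φ n) + (n ∸ length (φ n))                   ≡⟨ m+[n∸m]≡n |φn|≤n ⟩
  n                                                   ∎
  where
  open ≡-Reasoning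
  |φn|≤n : length (φ n) ≤ n
  |φn|≤n = subst (length (φ n) ≤_) (Bin.toℕ-fromℕ n) (length-φᵇ (Bin.fromℕ n))

s10∞-at-n : ∀ n → s10∞ n n ≡ true
s10∞-at-n n = subst (λ z → at (s n ++ [ true ]) z ≡ true)
  (trans (+-identityʳ (length (s n))) (length-s n)) (at-++ʳ (s n) [ true ] 0)

s10∞-beyond : ∀ n p → n < p → s10∞ n p ≡ false
s10∞-beyond n (suc p) (s≤s n≤p) =
  subst (λ z → at (s n ++ [ true ]) z ≡ false) position (at-++ʳ (s n) [ true ] (suc (p ∸ n)))
  where
  position : length (s n) + suc (p ∸ n) ≡ suc p
  position = trans (cong (_+ suc (p ∸ n)) (length-s n))
               (trans (+-suc n (p ∸ n)) (cong suc (m+[n∸m]≡n n≤p)))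

true≢false : true ≢ false
true≢false ()

search-≥ : ∀ (P : ℕ → Bool) x f → x ≤ searchFrom P x f
search-≥ P x zero = ≤-refl
search-≥ P x (suc f) with P x
... | true  = ≤-refl
... | false = ≤-trans (n≤1+n x) (search-≥ P (suc x) f)

search-≤ : ∀ (P : ℕ → Bool) x f → searchFrom P x f ≤ x + f
search-≤ P x zero = ≤-reflexive (sym (+-identityʳ x))
search-≤ P x (suc f) with P x
... | true  = m≤m+n x _
... | false = subst (searchFrom P (suc x) f ≤_) (sym (+-suc x f)) (search-≤ P (suc x) f)

search-finds : ∀ (P : ℕ → Bool) x f k → x ≤ k → k < x + f → P k ≡ true →
               P (searchFrom P x f) ≡ true
search-finds P x zero k x≤k k<x+0 _ =
  ⊥-elim (<-irrefl refl (<-≤-trans k<x+0 (≤-trans (≤-reflexive (+-identityʳ x)) x≤k)))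
search-finds P x (suc f) k x≤k k<x+f Pk with P x in Px
... | true  = Px
... | false with x ≟ k
...   | yes refl = ⊥-elim (true≢false (trans (sym Pk) Px))
...   | no x≢k = search-finds P (suc x) f k (≤∧≢⇒< x≤k x≢k) (subst (k <_) (+-suc x f) k<x+f) Pk

prime>1 : ∀ {q} → Prime q → 1 < q
prime>1 {q} pr = nonTrivial⇒n>1 q {{prime⇒nonTrivial pr}}

n∣n! : ∀ {n} → 0 < n → n ∣ n !
n∣n! {suc n} _ = m∣m*n (n !)

-- Euclid: every prime factor of p! + 1 exceeds p.
prime-above : ∀ p → Σ ℕ λ q → Prime q × p < q × q ≤ suc (p !)
prime-above p with factorise (suc (p !))
... | record { factors = [] ; isFactorisation = eq } = ⊥-elim (<-irrefl (sym (suc-injective eq)) (1≤n! p))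
... | record { factors = q ∷ rest ; isFactorisation = eq ; factorsPrime = q-prime ∷ _ } =
  q , q-prime , p<q , ∣⇒≤ q∣p!+1
  where
  q∣p!+1 : q ∣ suc (p !)
  q∣p!+1 = divides (product rest) (trans eq (*-comm q (product rest)))
  p<q : p < q
  p<q with p <? q
  ... | yes p<q = p<q
  ... | no p≮q = ⊥-elim (<-irrefl (sym (∣1⇒≡1 q∣1)) (prime>1 q-prime))
    where
    q∣p! : q ∣ p !
    q∣p! = ∣-trans (n∣n! (<-trans z<s (prime>1 q-prime))) (m≤n⇒m!∣n! (≮⇒≥ p≮q))
    q∣1 : q ∣ 1
    q∣1 = ∣m+n∣m⇒∣n (subst (q ∣_) (+-comm 1 (p !)) q∣p!+1) q∣p!

nthPrime-prime : ∀ j → Prime (nthPrime j)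
nthPrime-prime zero = prime[2]
nthPrime-prime (suc j) with prime-above (nthPrime j)
... | q , q-prime , pj<q , q≤ = decided (search-finds isPrimeᵇ (suc (nthPrime j)) (suc (nthPrime j !)) q
        pj<q (s≤s (≤-trans q≤ (m≤n+m _ (nthPrime j)))) (dec-true (prime? q) q-prime))
  where
  decided : ∀ {k} → isPrimeᵇ k ≡ true → Prime k
  decided {k} h with prime? k
  ... | yes pk = pk

nthPrime-step : ∀ j → nthPrime j < nthPrime (suc j)
nthPrime-step j = search-≥ isPrimeᵇ (suc (nthPrime j)) (suc (nthPrime j !))

nthPrime-mono : ∀ {j j'} → j < j' → nthPrime j < nthPrime j'
nthPrime-mono {j} {suc j'} (s≤s j≤j') with m≤n⇒m<n∨m≡n j≤j'
... | inj₁ j<j' = <-trans (nthPrime-mono j<j') (nthPrime-step j')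
... | inj₂ refl = nthPrime-step j

prime-∤-power : ∀ {d p} r → Prime d → Prime p → d < p → ¬ (d ∣ p ^ r)
prime-∤-power zero pd _ _ d∣1 = <-irrefl (sym (∣1⇒≡1 d∣1)) (prime>1 pd)
prime-∤-power {d} {p} (suc r) pd pp d<p d∣ with euclidsLemma p (p ^ r) pd d∣
... | inj₂ d∣p^r = prime-∤-power r pd pp d<p d∣p^r
... | inj₁ d∣p with prime⇒irreducible pp d∣p
...   | inj₁ d≡1 = <-irrefl (sym d≡1) (prime>1 pd)
...   | inj₂ d≡p = <-irrefl d≡p d<p

left-factor-pos : ∀ q r → 0 < q * r → 0 < q
left-factor-pos (suc q) r _ = z<s

prime-powers-bound : ∀ n a k → 0 < k → (∀ j → j < n → nthPrime j ∣ k) →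
                     nthPrime n ^ a ∣ k → 2 ^ (n + a) ≤ k
prime-powers-bound zero a k k>0 _ 2^a∣k = ∣⇒≤ {{>-nonZero k>0}} 2^a∣k
prime-powers-bound (suc n) a k k>0 smaller (divides q k≡q*pᵃ) = begin
  2 ^ (suc n + a)     ≡⟨ ^-distribˡ-+-* 2 (suc n) a ⟩
  2 ^ suc n * 2 ^ a   ≤⟨ *-mono-≤ 2^[1+n]≤q (^-monoˡ-≤ a (prime>1 (nthPrime-prime (suc n)))) ⟩
  q * nthPrime (suc n) ^ a ≡⟨ sym k≡q*pᵃ ⟩
  k                   ∎
  where
  open ≤-Reasoning
  q>0 : 0 < q
  q>0 = left-factor-pos q _ (subst (0 <_) k≡q*pᵃ k>0)
  divides-q : ∀ j → j < suc n → nthPrime j ∣ q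
  divides-q j j<1+n with euclidsLemma q _ (nthPrime-prime j) (subst (nthPrime j ∣_) k≡q*pᵃ (smaller j j<1+n))
  ... | inj₁ pj∣q = pj∣q
  ... | inj₂ pj∣pᵃ = ⊥-elim (prime-∤-power a (nthPrime-prime j) (nthPrime-prime (suc n)) (nthPrime-mono j<1+n) pj∣pᵃ)
  2^[1+n]≤q : 2 ^ suc n ≤ q
  2^[1+n]≤q = subst (λ e → 2 ^ e ≤ q) (+-comm n 1)
    (prime-powers-bound n 1 q q>0 (λ j j<n → divides-q j (m<n⇒m<1+n j<n))
      (subst (_∣ q) (sym (*-identityʳ _)) (divides-q n (n<1+n n))))

-- The codes t_l: every entry obeys i + t_l(i) < l.  The entry ψ(l)(i) = e comes from a
-- number below 2^(l+1) divisible by p_0, …, p_{i-1} and by p_i^(e+1).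

multiplicity-divides : ∀ f p m → p ^ multAux f p m ∣ m
multiplicity-divides zero    p       m       = 1∣ m
multiplicity-divides (suc f) zero    m       = 1∣ m
multiplicity-divides (suc f) (suc p) zero    = 1∣ 0
multiplicity-divides (suc f) (suc p) (suc m) = by-test (suc p ∣? suc m)
  where
  by-test : (test : Dec (suc p ∣ suc m)) →
            suc p ^ (if does test then suc (multAux f (suc p) (suc m / suc p)) else 0) ∣ suc m
  by-test (yes p∣m) = subst (suc p * suc p ^ multAux f (suc p) (suc m / suc p) ∣_) (m*[n/m]≡n p∣m)
                        (*-monoʳ-∣ (suc p) (multiplicity-divides f (suc p) (suc m / suc p)))
  by-test (no _) = 1∣ _

power-divides : ∀ p m → p ∣ m → p ^ suc (mult p m ∸ 1) ∣ m
power-divides p m p∣m with mult p m | multiplicity-divides m p m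
... | zero  | _  = subst (_∣ m) (sym (*-identityʳ p)) p∣m
... | suc r | pʳ⁺¹∣m = pʳ⁺¹∣m

decode-divisors : ∀ f j m i → i < length (decodeAux f j m) →
  (∀ k → k < i → nthPrime (j + k) ∣ m) × nthPrime (j + i) ^ suc (atℕ (decodeAux f j m) i) ∣ m
decode-divisors (suc f) j m i i<len with nthPrime j ∣? m
decode-divisors (suc f) j m zero _ | yes pj∣m =
  (λ _ ()) , subst (λ z → nthPrime z ^ suc (mult (nthPrime j) m ∸ 1) ∣ m) (sym (+-identityʳ j)) (power-divides (nthPrime j) m pj∣m)
decode-divisors (suc f) j m (suc i) (s≤s i<len) | yes pj∣m with decode-divisors f (suc j) m i i<len
... | earlier , power = earlier′ , subst (λ z → nthPrime z ^ suc (atℕ (decodeAux f (suc j) m) i) ∣ m) (sym (+-suc j i)) power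
  where
  earlier′ : ∀ k → k < suc i → nthPrime (j + k) ∣ m
  earlier′ zero    _         = subst (λ z → nthPrime z ∣ m) (sym (+-identityʳ j)) pj∣m
  earlier′ (suc k) (s≤s k<i) = subst (λ z → nthPrime z ∣ m) (sym (+-suc j k)) (earlier k k<i)

enumIm-pos : ∀ l → 0 < enumIm l
enumIm-pos zero    = z<s
enumIm-pos (suc l) = ≤-trans z<s (search-≥ inImᵇ (suc (enumIm l)) (enumIm l))

enumIm-bound : ∀ l → enumIm l < 2 ^ suc l
enumIm-bound zero = s≤s (s≤s z≤n)
enumIm-bound (suc l) = begin-strict
  searchFrom inImᵇ (suc x) x ≤⟨ search-≤ inImᵇ (suc x) x ⟩
  suc x + x                 <⟨ +-monoʳ-< (suc x) (n<1+n x) ⟩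
  suc x + suc x             ≤⟨ +-mono-≤ ih (≤-trans ih (≤-reflexive (sym (+-identityʳ _)))) ⟩
  2 ^ suc l + (2 ^ suc l + 0) ∎
  where
  open ≤-Reasoning
  x = enumIm l
  ih : suc x ≤ 2 ^ suc l
  ih = enumIm-bound l

ψ-bound : ∀ l i → i < length (ψ l) → i + atℕ (ψ l) i < l
ψ-bound l i i<len with decode-divisors (enumIm l) 0 (enumIm l) i i<len
... | earlier , power with (i + suc e) <? suc l
  where e = atℕ (ψ l) i
...   | yes lt = subst (_≤ l) (+-suc i _) (≤-pred lt)
...   | no ¬lt = ⊥-elim (<-irrefl refl (<-≤-trans (enumIm-bound l)
                   (≤-trans (^-monoʳ-≤ 2 (≮⇒≥ ¬lt))
                     (prime-powers-bound i _ (enumIm l) (enumIm-pos l) earlier power))))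

atℕ-++ˡ : ∀ (xs ys : List ℕ) k → k < length xs → atℕ (xs ++ ys) k ≡ atℕ xs k
atℕ-++ˡ (x ∷ xs) ys zero    _         = refl
atℕ-++ˡ (x ∷ xs) ys (suc k) (s≤s k<n) = atℕ-++ˡ xs ys k k<n

atℕ-++ʳ : ∀ (xs ys : List ℕ) k → atℕ (xs ++ ys) (length xs + k) ≡ atℕ ys k
atℕ-++ʳ []       ys k = refl
atℕ-++ʳ (x ∷ xs) ys k = atℕ-++ʳ xs ys k

atℕ-zeros : ∀ n k → atℕ (replicate n 0) k ≡ 0
atℕ-zeros zero    zero    = refl
atℕ-zeros zero    (suc k) = refl
atℕ-zeros (suc n) zero    = refl
atℕ-zeros (suc n) (suc k) = atℕ-zeros n k

t-bound : ∀ l i → i < l → i + atℕ (t l) i < l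
t-bound l i i<l with i <? length (ψ l)
... | yes i<len = subst (λ z → i + z < l) (sym (atℕ-++ˡ (ψ l) _ i i<len)) (ψ-bound l i i<len)
... | no i≮len = subst (λ z → i + z < l) (sym padding) (subst (_< l) (sym (+-identityʳ i)) i<l)
  where
  padding : atℕ (t l) i ≡ 0
  padding = trans (cong (atℕ (t l)) (sym (m+[n∸m]≡n (≮⇒≥ i≮len))))
              (trans (atℕ-++ʳ (ψ l) _ (i ∸ length (ψ l))) (atℕ-zeros (l ∸ length (ψ l)) _))

length-flip : ∀ v n → length (flipAt v n) ≡ length v
length-flip []      n       = refl
length-flip (x ∷ v) zero    = refl
length-flip (x ∷ v) (suc n) = cong suc (length-flip v n)

at-flip-other : ∀ v n j → j ≢ n → at (flipAt v n) j ≡ at v j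
at-flip-other []      n       j       _   = refl
at-flip-other (x ∷ v) zero    zero    j≢n = ⊥-elim (j≢n refl)
at-flip-other (x ∷ v) zero    (suc j) _   = refl
at-flip-other (x ∷ v) (suc n) zero    _   = refl
at-flip-other (x ∷ v) (suc n) (suc j) j≢n = at-flip-other v n j (j≢n ∘ cong suc)

at-flip-here : ∀ (v : List Bool) n → n < length v → at (flipAt v n) n ≡ not (at v n)
at-flip-here (x ∷ v) zero    _         = refl
at-flip-here (x ∷ v) (suc n) (s≤s n<v) = at-flip-here v n n<v

flip-involutive : ∀ v n → flipAt (flipAt v n) n ≡ v
flip-involutive []      n       = refl
flip-involutive (x ∷ v) zero    = cong (_∷ v) (not-involutive x)
flip-involutive (x ∷ v) (suc n) = cong (x ∷_) (flip-involutive v n)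

flip-beyond : ∀ (v : List Bool) n → length v ≤ n → flipAt v n ≡ v
flip-beyond []      n       _         = refl
flip-beyond (x ∷ v) (suc n) (s≤s v≤n) = cong (x ∷_) (flip-beyond v n v≤n)

take-flip : ∀ k (v : List Bool) n → take k (flipAt v n) ≡ flipAt (take k v) n
take-flip zero    v       n       = refl
take-flip (suc k) []      n       = refl
take-flip (suc k) (x ∷ v) zero    = refl
take-flip (suc k) (x ∷ v) (suc n) = cong (x ∷_) (take-flip k v n)

at-take : ∀ k (v : List Bool) j → j < k → at (take k v) j ≡ at v j
at-take (suc k) []      j       _         = refl
at-take (suc k) (x ∷ v) zero    _         = refl
at-take (suc k) (x ∷ v) (suc j) (s≤s j<k) = at-take k v j j<k

length-take≤ : ∀ k (v : List Bool) → k ≤ length v → length (take k v) ≡ k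
length-take≤ k v k≤v = trans (length-take k v) (m≤n⇒m⊓n≡m k≤v)

rowOf : ℕ → ℕ
rowOf n = proj₁ (unpair (n ∸ 1))

colOf : ℕ → ℕ
colOf n = proj₂ (unpair (n ∸ 1))

-- v is placed when read as a sequence of length n (n = length v gives Placed v); the length is
-- a separate parameter so that the notion transports along length-preserving edits.
record PlacedAt (n : ℕ) (v : List Bool) : Set where
  field
    nonempty  : 0 < n
    rows      : ∀ i p → i < rowOf n → ⟨ i , p ⟩ < n → at v ⟨ i , p ⟩ ≡ s10∞ (atℕ (t (rowOf n)) i) p
    ends-in-1 : 0 < colOf n → at v (n ∸ 1) ≡ true

placed⇒PlacedAt : ∀ v → Placed v → PlacedAt (length v) v
placed⇒PlacedAt (x ∷ xs) (rows , last) = record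
  { nonempty = z<s ; rows = rows′ ; ends-in-1 = last }
  where
  rows′ : ∀ i p → i < lOf (x ∷ xs) → ⟨ i , p ⟩ < suc (length xs) → _
  rows′ i p i<l ip<n with rows (fromℕ< i<l) (fromℕ< (≤-<-trans (p≤pair i p) ip<n))
  ... | rowᵢ rewrite toℕ-fromℕ< i<l | toℕ-fromℕ< (≤-<-trans (p≤pair i p) ip<n) = rowᵢ ip<n

PlacedAt⇒placed : ∀ v → PlacedAt (length v) v → Placed v
PlacedAt⇒placed (x ∷ xs) P = (λ i p → rows (toℕ i) (toℕ p) (toℕ<n i)) , ends-in-1
  where open PlacedAt P

-- Placedness ignores the start ⟨l,0⟩ of every row l ≥ l(v): it reads only rows below l(v) and,
-- when colOf n > 0, the last entry, which is not a row start.
PlacedAt-flip : ∀ {n v l} → rowOf n ≤ l → PlacedAt n v → PlacedAt n (flipAt v ⟨ l , 0 ⟩)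
PlacedAt-flip {n} {v} {l} row≤l P = record
  { nonempty  = nonempty
  ; rows      = λ i p i<row ip<n →
      trans (at-flip-other v _ _ (λ eq → <⇒≢ (<-≤-trans i<row row≤l) (proj₁ (pair-injective i p l 0 eq))))
            (rows i p i<row ip<n)
  ; ends-in-1 = λ col>0 →
      trans (at-flip-other v _ _ (λ eq → <⇒≢ col>0 (sym (proj₂ (pair-injective (rowOf n) (colOf n) l 0
               (trans (pair-unpair (n ∸ 1)) eq))))))
            (ends-in-1 col>0)
  }
  where open PlacedAt P

flip-placed : ∀ {v} l → lOf v ≤ l → Placed v → Placed (flipAt v ⟨ l , 0 ⟩)
flip-placed {v} l l≤ pv = PlacedAt⇒placed _
  (subst (λ n → PlacedAt n (flipAt v ⟨ l , 0 ⟩)) (sym (length-flip v _))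
    (PlacedAt-flip l≤ (placed⇒PlacedAt v pv)))

lOf-flip : ∀ v n → lOf (flipAt v n) ≡ lOf v
lOf-flip v n = cong rowOf (length-flip v n)

flip-placed⇔ : ∀ {v} l → lOf v ≤ l → Placed v ⇔ Placed (flipAt v ⟨ l , 0 ⟩)
flip-placed⇔ {v} l l≤ = mk⇔ (flip-placed l l≤)
  (λ pv′ → subst Placed (flip-involutive v _)
             (flip-placed l (subst (_≤ l) (sym (lOf-flip v _)) l≤) pv′))

last-position : ∀ v → lenm v ≡ ⟨ lOf v , colOf (length v) ⟩
last-position v = sym (pair-unpair (lenm v))

placed-length : ∀ v → Placed v → suc (lenm v) ≡ length v
placed-length (x ∷ v) _ = refl

lenm<length : ∀ v → Placed v → lenm v < length v
lenm<length (x ∷ v) _ = n<1+n (length v)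

row-start-inside : ∀ v → Placed v → ⟨ lOf v , 0 ⟩ < length v
row-start-inside v pv = ≤-<-trans
  (subst (⟨ lOf v , 0 ⟩ ≤_) (sym (last-position v)) (pair-row-start (lOf v) _))
  (lenm<length v pv)

earlier-diagonal-inside : ∀ v l c → l + c < lOf v → ⟨ l , c ⟩ < lenm v
earlier-diagonal-inside v l c l+c<lv = subst (⟨ l , c ⟩ <_) (sym (last-position v))
  (pair-<-diagonal l c (lOf v) _ (≤-trans l+c<lv (m≤m+n _ _)))

row-pattern : ∀ v → Placed v → ∀ i p → i < lOf v → ⟨ i , p ⟩ < length v →
              at v ⟨ i , p ⟩ ≡ s10∞ (atℕ (t (lOf v)) i) p
row-pattern v pv = PlacedAt.rows (placed⇒PlacedAt v pv)

row-end-inside : ∀ v → Placed v → ∀ i → i < lOf v → suc ⟨ i , atℕ (t (lOf v)) i ⟩ < length v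
row-end-inside v pv i i<lv =
  <-≤-trans (s≤s (earlier-diagonal-inside v i _ (t-bound (lOf v) i i<lv))) (lenm<length v pv)

last-entry : ∀ v → Placed v → 0 < colOf (length v) → at v (lenm v) ≡ true
last-entry v pv = PlacedAt.ends-in-1 (placed⇒PlacedAt v pv)

lOf-take : ∀ k w → k ≤ length w → lOf (take k w) ≡ rowOf k
lOf-take k w k≤w = cong rowOf (length-take≤ k w k≤w)

prefix-placed : ∀ {w l} b → Placed w → lOf w ≡ l → ⟨ l , b ⟩ < length w →
                (0 < b → at w ⟨ l , b ⟩ ≡ true) → LPlaced l (take (suc ⟨ l , b ⟩) w)
prefix-placed {w} {l} b pw refl q<w ends =
  PlacedAt⇒placed v (subst (λ n → PlacedAt n v) (sym |v|≡k) P) ,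
  trans (lOf-take k w q<w) row-k
  where
  q = ⟨ l , b ⟩
  k = suc q
  v = take k w
  |v|≡k : length v ≡ k
  |v|≡k = length-take≤ k w q<w
  row-k : rowOf k ≡ l
  row-k = cong proj₁ (unpair-pair l b)
  col-k : colOf k ≡ b
  col-k = cong proj₂ (unpair-pair l b)
  P : PlacedAt k v
  P = record
    { nonempty  = z<s
    ; rows      = λ i p i<row ip<k → trans (at-take k w _ ip<k)
        (trans (row-pattern w pw i p (subst (i <_) row-k i<row) (<-≤-trans ip<k q<w))
               (cong (λ r → s10∞ (atℕ (t r) i) p) (sym row-k)))
    ; ends-in-1 = λ col>0 → trans (at-take k w q (n<1+n q)) (ends (subst (0 <_) col-k col>0))
    }

ε-prefix : ∀ {w l} k → Placed w → lOf w ≡ l → k ≤ length w → LPlaced l (take k w) →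
           ε (take k w) ≡ ε w
ε-prefix {w} {l} k pw refl k≤w (pv , lv≡l) = begin
  at (take k w) ⟨ lOf (take k w) , 0 ⟩ ≡⟨ cong (λ r → at (take k w) ⟨ r , 0 ⟩) lv≡l ⟩
  at (take k w) ⟨ l , 0 ⟩              ≡⟨ at-take k w _ start<k ⟩
  at w ⟨ l , 0 ⟩                       ∎
  where
  open ≡-Reasoning
  start<k : ⟨ l , 0 ⟩ < k
  start<k = subst₂ (λ r n → ⟨ r , 0 ⟩ < n) lv≡l (length-take≤ k w k≤w) (row-start-inside (take k w) pv)

sup-at : ∀ {v l} → lOf v ≡ l → sup v ≡ flipAt v ⟨ l , 0 ⟩
sup-at refl = refl

-- Longest proper prefixes.  u^- and u^{-l} are the longest proper prefixes of u that are placed,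
-- resp. (≤ l)-placed; we argue about them through the following specification.

record Longest (P : List Bool → Set) (w : List Bool) (k : ℕ) : Set where
  field
    proper  : k < length w
    holds   : P (take k w)
    longest : ∀ j → j < length w → P (take j w) → j ≤ k

longest-unique : ∀ {P w k k′} → Longest P w k → Longest P w k′ → k ≡ k′
longest-unique L L′ = ≤-antisym (Longest.longest L′ _ (Longest.proper L) (Longest.holds L))
                                (Longest.longest L _ (Longest.proper L′) (Longest.holds L′))

longest-transfer : ∀ {P Q w w′ k} → length w ≡ length w′ →
  (∀ j → j < length w → P (take j w) ⇔ Q (take j w′)) → Longest P w k → Longest Q w′ k
longest-transfer {w = w} {w′} {k} |w|≡|w′| P⇔Q L = record
  { proper  = subst (k <_) |w|≡|w′| proper
  ; holds   = Equivalence.to (P⇔Q k proper) holds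
  ; longest = λ j j<w′ Qj → let j<w = subst (j <_) (sym |w|≡|w′|) j<w′ in
                longest j j<w (Equivalence.from (P⇔Q j j<w) Qj)
  }
  where open Longest L

maxBelow-< : ∀ P n → 0 < n → maxBelow P n < n
maxBelow-< P (suc n) _ with P n
... | true  = n<1+n n
... | false = s≤s (maxBelow-≤ n)
  where
  maxBelow-≤ : ∀ n → maxBelow P n ≤ n
  maxBelow-≤ zero = z≤n
  maxBelow-≤ (suc n) with P n
  ... | true  = n≤1+n n
  ... | false = m≤n⇒m≤1+n (maxBelow-≤ n)

maxBelow-finds : ∀ P n k → k < n → P k ≡ true → P (maxBelow P n) ≡ true × k ≤ maxBelow P n
maxBelow-finds P (suc n) k k<1+n Pk with P n in Pn
... | true  = Pn , ≤-pred k<1+n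
... | false with k ≟ n
...   | yes refl = ⊥-elim (true≢false (trans (sym Pk) Pn))
...   | no k≢n = maxBelow-finds P n k (≤∧≢⇒< (≤-pred k<1+n) k≢n) Pk

witness : ∀ {A : Set} (d : Dec A) → does d ≡ true → A
witness (yes a) _ = a

longest-search : ∀ {P} (P? : ∀ v → Dec (P v)) w → 1 < length w → P (take 1 w) →
                 Longest P w (maxBelow (λ k → does (P? (take k w))) (length w))
longest-search P? w 1<w P1 = record
  { proper  = maxBelow-< test (length w) (<-trans z<s 1<w)
  ; holds   = witness (P? _) (proj₁ (maxBelow-finds test (length w) 1 1<w (dec-true (P? _) P1)))
  ; longest = λ j j<w Pj → proj₂ (maxBelow-finds test (length w) j j<w (dec-true (P? _) Pj))
  }
  where
  test : ℕ → Bool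
  test k = does (P? (take k w))

singleton-placed : ∀ x → Placed (x ∷ [])
singleton-placed x = (λ ()) , (λ ())

minus-exists : ∀ w → 2 ≤ length w → Σ ℕ (Longest Placed w)
minus-exists w@(x ∷ y ∷ r) 2≤w = _ , longest-search Placed? w 2≤w (singleton-placed x)
minus-exists (x ∷ []) (s≤s ())

minus-is : ∀ {w k} → 2 ≤ length w → Longest Placed w k → minus w ≡ take k w
minus-is {w@(x ∷ y ∷ r)} 2≤w L = cong (λ k → take k w)
  (longest-unique (longest-search Placed? w 2≤w (singleton-placed x)) L)
minus-is {x ∷ []} (s≤s ())

minusL-exists : ∀ l w → 2 ≤ length w → Σ ℕ (Longest (LeqPlaced l) w)
minusL-exists l w@(x ∷ y ∷ r) 2≤w = _ , longest-search (LeqPlaced? l) w 2≤w (singleton-placed x , z≤n)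
minusL-exists l (x ∷ []) (s≤s ())

minusL-is : ∀ {l w k} → 2 ≤ length w → Longest (LeqPlaced l) w k → minusL l w ≡ take k w
minusL-is {l} {w@(x ∷ y ∷ r)} 2≤w L = cong (λ k → take k w)
  (longest-unique (longest-search (LeqPlaced? l) w 2≤w (singleton-placed x , z≤n)) L)
minusL-is {w = x ∷ []} (s≤s ())

-- Flipping the start of row l preserves (≤ l)- and l-placedness, hence does not move u^{-l}.

flip-leq-placed⇔ : ∀ {v} l → LeqPlaced l v ⇔ LeqPlaced l (flipAt v ⟨ l , 0 ⟩)
flip-leq-placed⇔ {v} l = mk⇔
  (λ (pv , lv≤l) → flip-placed l lv≤l pv , subst (_≤ l) (sym (lOf-flip v _)) lv≤l)
  (λ (pv′ , lv′≤l) → let lv≤l = subst (_≤ l) (lOf-flip v _) lv′≤l in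
                      Equivalence.from (flip-placed⇔ l lv≤l) pv′ , lv≤l)

flip-l-placed⇔ : ∀ {v} l → LPlaced l v ⇔ LPlaced l (flipAt v ⟨ l , 0 ⟩)
flip-l-placed⇔ {v} l = mk⇔
  (λ (pv , lv≡l) → flip-placed l (≤-reflexive lv≡l) pv , trans (lOf-flip v _) lv≡l)
  (λ (pv′ , lv′≡l) → let lv≡l = trans (sym (lOf-flip v _)) lv′≡l in
                      Equivalence.from (flip-placed⇔ l (≤-reflexive lv≡l)) pv′ , lv≡l)

minusL-flip : ∀ l w → 2 ≤ length w → minusL l (flipAt w ⟨ l , 0 ⟩) ≡ flipAt (minusL l w) ⟨ l , 0 ⟩
minusL-flip l w 2≤w with minusL-exists l w 2≤w
... | k , L = begin
  minusL l w′              ≡⟨ minusL-is (subst (2 ≤_) (sym |w′|≡|w|) 2≤w) L′ ⟩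
  take k w′                ≡⟨ take-flip k w _ ⟩
  flipAt (take k w) ⟨ l , 0 ⟩ ≡⟨ cong (λ v → flipAt v ⟨ l , 0 ⟩) (sym (minusL-is 2≤w L)) ⟩
  flipAt (minusL l w) ⟨ l , 0 ⟩ ∎
  where
  open ≡-Reasoning
  w′ = flipAt w ⟨ l , 0 ⟩
  |w′|≡|w| : length w′ ≡ length w
  |w′|≡|w| = length-flip w _
  L′ : Longest (LeqPlaced l) w′ k
  L′ = longest-transfer (sym |w′|≡|w|)
         (λ j _ → subst (λ v → LeqPlaced l (take j w) ⇔ LeqPlaced l v) (sym (take-flip j w _))
                    (flip-leq-placed⇔ l)) L

minusL-of-low-minus : ∀ l w → 2 ≤ length w → LeqPlaced l (minus w) → minusL l w ≡ minus w
minusL-of-low-minus l w 2≤w low with minus-exists w 2≤w | minusL-exists l w 2≤w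
... | m , M | mL , ML = begin
  minusL l w ≡⟨ minusL-is 2≤w ML ⟩
  take mL w  ≡⟨ cong (λ k → take k w) (≤-antisym mL≤m m≤mL) ⟩
  take m w   ≡⟨ sym (minus-is 2≤w M) ⟩
  minus w    ∎
  where
  open ≡-Reasoning
  mL≤m : mL ≤ m
  mL≤m = Longest.longest M mL (Longest.proper ML) (proj₁ (Longest.holds ML))
  m≤mL : m ≤ mL
  m≤mL = Longest.longest ML m (Longest.proper M) (subst (LeqPlaced l) (minus-is 2≤w M) low)

ε-minus : ∀ {u l} → Placed u → lOf u ≡ l → 2 ≤ length u → LPlaced l (minus u) → ε (minus u) ≡ ε u
ε-minus {u} pu lu 2≤u lp with minus-exists u 2≤u
... | m , M rewrite minus-is 2≤u M = ε-prefix m pu lu (<⇒≤ (Longest.proper M)) lp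

ε-minusL : ∀ {u l} → Placed u → lOf u ≡ l → 2 ≤ length u → LPlaced l (minusL l u) → ε (minusL l u) ≡ ε u
ε-minusL {u} {l} pu lu 2≤u lp with minusL-exists l u 2≤u
... | k , K rewrite minusL-is 2≤u K = ε-prefix k pu lu (<⇒≤ (Longest.proper K)) lp

-- When ⟨l,0⟩ is the last position of u, flipping it changes no proper prefix; and no proper
-- prefix can be (> l)-placed, since a (> l)-placed sequence extends past ⟨l,0⟩.

flip-last-keeps-prefixes : ∀ w n → length w ≡ suc n → ∀ j → j < length w → take j (flipAt w n) ≡ take j w
flip-last-keeps-prefixes w n |w|≡1+n j j<w = trans (take-flip j w n)
  (flip-beyond (take j w) n (subst (_≤ n) (sym (length-take≤ j w (<⇒≤ j<w)))
                                (≤-pred (subst (j <_) |w|≡1+n j<w))))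

minus-flip-last : ∀ w n → 2 ≤ length w → length w ≡ suc n → minus (flipAt w n) ≡ minus w
minus-flip-last w n 2≤w |w|≡1+n with minus-exists w 2≤w
... | k , K = begin
  minus (flipAt w n)   ≡⟨ minus-is (subst (2 ≤_) (sym (length-flip w n)) 2≤w) K′ ⟩
  take k (flipAt w n)  ≡⟨ same k (Longest.proper K) ⟩
  take k w             ≡⟨ sym (minus-is 2≤w K) ⟩
  minus w              ∎
  where
  open ≡-Reasoning
  same = flip-last-keeps-prefixes w n |w|≡1+n
  K′ : Longest Placed (flipAt w n) k
  K′ = longest-transfer (sym (length-flip w n))
         (λ j j<w → subst (λ v → Placed (take j w) ⇔ Placed v) (sym (same j j<w)) (mk⇔ id id)) K

minusL-flip-last : ∀ l w n → 2 ≤ length w → length w ≡ suc n → minusL l (flipAt w n) ≡ minusL l w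
minusL-flip-last l w n 2≤w |w|≡1+n with minusL-exists l w 2≤w
... | k , K = begin
  minusL l (flipAt w n)  ≡⟨ minusL-is (subst (2 ≤_) (sym (length-flip w n)) 2≤w) K′ ⟩
  take k (flipAt w n)    ≡⟨ same k (Longest.proper K) ⟩
  take k w               ≡⟨ sym (minusL-is 2≤w K) ⟩
  minusL l w             ∎
  where
  open ≡-Reasoning
  same = flip-last-keeps-prefixes w n |w|≡1+n
  K′ : Longest (LeqPlaced l) (flipAt w n) k
  K′ = longest-transfer (sym (length-flip w n))
         (λ j j<w → subst (λ v → LeqPlaced l (take j w) ⇔ LeqPlaced l v) (sym (same j j<w)) (mk⇔ id id)) K

higher-is-long : ∀ {v l} → GtPlaced l v → suc ⟨ l , 0 ⟩ < length v
higher-is-long {v} {l} (pv , l<lv) = ≤-<-trans (s≤s (pair-row-start l _)) (row-end-inside v pv l l<lv)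

minus-not-higher-if-short : ∀ {w l} → 2 ≤ length w → length w ≡ suc ⟨ l , 0 ⟩ → ¬ GtPlaced l (minus w)
minus-not-higher-if-short {w} {l} 2≤w |w|≡ higher with minus-exists w 2≤w
... | k , K = <-irrefl refl (<-≤-trans (higher-is-long higher) (begin
  length (minus w)  ≡⟨ cong length (minus-is 2≤w K) ⟩
  length (take k w) ≡⟨ length-take≤ k w (<⇒≤ (Longest.proper K)) ⟩
  k                 ≤⟨ ≤-pred (subst (k <_) |w|≡ (Longest.proper K)) ⟩
  ⟨ l , 0 ⟩         <⟨ n<1+n _ ⟩
  suc ⟨ l , 0 ⟩     ∎))
  where open ≤-Reasoning

-- The long case, |u| > ⟨l,0⟩ + 1: the prefix of u ending at ⟨l,0⟩ is l-placed, so u^- is at least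
-- as long, and the row patterns of u force u^- to be l- or (> l)-placed.

-- A placed prefix of an l-placed w reaching past ⟨l,0⟩ has index ≥ l: were its index a < l,
-- its last entry ⟨a,b⟩ would lie on a diagonal after ⟨l,0⟩, beyond the final 1 of row a of w,
-- yet a placed sequence ends in 1 there.
no-lower-prefix : ∀ {w l} k → Placed w → lOf w ≡ l → k ≤ length w → suc ⟨ l , 0 ⟩ < k →
                  ¬ LtPlaced l (take k w)
no-lower-prefix {w} k pw refl k≤w long (pv , a<l) = true≢false (trans (sym entry-is-1) entry-is-0)
  where
  v = take k w
  a = lOf v
  b = colOf (length v)
  c = atℕ (t (lOf w)) a
  |v|≡k : length v ≡ k
  |v|≡k = length-take≤ k w k≤w
  end<k : ⟨ a , b ⟩ < k
  end<k = subst₂ _<_ (last-position v) |v|≡k (lenm<length v pv)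
  start<end : ⟨ lOf w , 0 ⟩ < ⟨ a , b ⟩
  start<end = subst (⟨ lOf w , 0 ⟩ <_) (last-position v)
    (≤-pred (subst (suc ⟨ lOf w , 0 ⟩ <_) (sym (trans (placed-length v pv) |v|≡k)) long))
  l≤a+b : lOf w ≤ a + b
  l≤a+b = ≮⇒≥ (λ a+b<l → <⇒≱ start<end
    (<⇒≤ (pair-<-diagonal a b (lOf w) 0 (subst (a + b <_) (sym (+-identityʳ _)) a+b<l))))
  c<b : c < b
  c<b = +-cancelˡ-< a c b (<-≤-trans (t-bound (lOf w) a a<l) l≤a+b)
  entry-is-1 : at w ⟨ a , b ⟩ ≡ true
  entry-is-1 = trans (sym (at-take k w _ end<k))
    (subst (λ q → at v q ≡ true) (last-position v) (last-entry v pv (≤-<-trans z≤n c<b)))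
  entry-is-0 : at w ⟨ a , b ⟩ ≡ false
  entry-is-0 = trans (row-pattern w pw a b a<l (<-≤-trans end<k k≤w)) (s10∞-beyond c b c<b)

longest-not-lower : ∀ {w l m} → Placed w → lOf w ≡ l → suc ⟨ l , 0 ⟩ < length w →
                    Longest Placed w m → ¬ LtPlaced l (take m w)
longest-not-lower {w} {l} {m} pw lw long M lower =
  [ past-start , at-start ]′ (m≤n⇒m<n∨m≡n start≤m)
  where
  start-prefix : LPlaced l (take (suc ⟨ l , 0 ⟩) w)
  start-prefix = prefix-placed 0 pw lw (<-trans (n<1+n _) long) (λ ())
  start≤m : suc ⟨ l , 0 ⟩ ≤ m
  start≤m = Longest.longest M _ long (proj₁ start-prefix)
  past-start : suc ⟨ l , 0 ⟩ < m → ⊥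
  past-start start<m = no-lower-prefix m pw lw (<⇒≤ (Longest.proper M)) start<m lower
  at-start : suc ⟨ l , 0 ⟩ ≡ m → ⊥
  at-start eq = <-irrefl (subst (λ k → lOf (take k w) ≡ l) eq (proj₂ start-prefix)) (proj₂ lower)

-- Two sequences differing exactly at ⟨l,0⟩ cannot both show row patterns s_c 1 0^∞ (with codes
-- cx, cy) on a common stretch of row l containing both final 1s: equal codes clash at ⟨l,0⟩,
-- and otherwise the later final 1 sits where the other pattern already reads 0.

row-start≢ : ∀ l {c} → 0 < c → ⟨ l , c ⟩ ≢ ⟨ l , 0 ⟩
row-start≢ l {c} c>0 eq = <⇒≢ c>0 (sym (proj₂ (pair-injective l c l 0 eq)))

module RowPatterns {x y : List Bool} (l K : ℕ)
  (agree : ∀ j → j ≢ ⟨ l , 0 ⟩ → at x j ≡ at y j) where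

  later-end-clash : ∀ {cx cy} → (∀ p → ⟨ l , p ⟩ < K → at x ⟨ l , p ⟩ ≡ s10∞ cx p) →
    (∀ p → ⟨ l , p ⟩ < K → at y ⟨ l , p ⟩ ≡ s10∞ cy p) → cx < cy → ⟨ l , cy ⟩ < K → ⊥
  later-end-clash {cx} {cy} row-x row-y cx<cy end-y<K = true≢false (begin
    true              ≡⟨ sym (s10∞-at-n cy) ⟩
    s10∞ cy cy        ≡⟨ sym (row-y cy end-y<K) ⟩
    at y ⟨ l , cy ⟩   ≡⟨ sym (agree _ (row-start≢ l (≤-<-trans z≤n cx<cy))) ⟩
    at x ⟨ l , cy ⟩   ≡⟨ row-x cy end-y<K ⟩
    s10∞ cx cy        ≡⟨ s10∞-beyond cx cy cx<cy ⟩
    false             ∎)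
    where open ≡-Reasoning

rows-clash : ∀ {x y : List Bool} l {K cx cy} →
  (∀ j → j ≢ ⟨ l , 0 ⟩ → at x j ≡ at y j) → at x ⟨ l , 0 ⟩ ≢ at y ⟨ l , 0 ⟩ →
  (∀ p → ⟨ l , p ⟩ < K → at x ⟨ l , p ⟩ ≡ s10∞ cx p) →
  (∀ p → ⟨ l , p ⟩ < K → at y ⟨ l , p ⟩ ≡ s10∞ cy p) →
  ⟨ l , cx ⟩ < K → ⟨ l , cy ⟩ < K → ⊥
rows-clash {x} {y} l {K} {cx} {cy} agree differ row-x row-y end-x<K end-y<K with <-cmp cx cy
... | tri< cx<cy _ _ = RowPatterns.later-end-clash {x} {y} l K agree row-x row-y cx<cy end-y<K
... | tri> _ _ cy<cx = RowPatterns.later-end-clash {y} {x} l K (λ j ne → sym (agree j ne)) row-y row-x cy<cx end-x<K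
... | tri≈ _ refl _ = differ (trans (row-x 0 start<K) (sym (row-y 0 start<K)))
  where
  start<K = ≤-<-trans (pair-row-start l cx) end-x<K

prefix-row : ∀ {x k} i p → k ≤ length x → Placed (take k x) → i < lOf (take k x) → ⟨ i , p ⟩ < k →
             at x ⟨ i , p ⟩ ≡ s10∞ (atℕ (t (lOf (take k x))) i) p
prefix-row {x} {k} i p k≤x pv i<lv ip<k = trans (sym (at-take k x _ ip<k))
  (row-pattern (take k x) pv i p i<lv (subst (⟨ i , p ⟩ <_) (sym (length-take≤ k x k≤x)) ip<k))

prefix-row-end : ∀ {x k} i → k ≤ length x → Placed (take k x) → i < lOf (take k x) →
                 suc ⟨ i , atℕ (t (lOf (take k x))) i ⟩ < k
prefix-row-end {x} {k} i k≤x pv i<lv =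
  subst (suc ⟨ i , atℕ (t (lOf (take k x))) i ⟩ <_) (length-take≤ k x k≤x) (row-end-inside (take k x) pv i i<lv)

-- Let y differ from the l-placed x exactly at ⟨l,0⟩.  Then the longest placed proper prefix of x
-- and a longer placed prefix of y are never both (> l)-placed: if y's final 1 in row l falls
-- inside x's prefix the row patterns clash; otherwise it extends x's prefix to a longer
-- l-placed prefix of x.
no-two-higher : ∀ {x y : List Bool} {l mx my} → length x ≡ length y →
  (∀ j → j ≢ ⟨ l , 0 ⟩ → at x j ≡ at y j) → at x ⟨ l , 0 ⟩ ≢ at y ⟨ l , 0 ⟩ →
  Placed x → lOf x ≡ l → Longest Placed x mx → mx ≤ my → my ≤ length y →
  GtPlaced l (take mx x) → GtPlaced l (take my y) → ⊥
no-two-higher {x} {y} {l} {mx} {my} |x|≡|y| agree differ px lx M mx≤my my≤y (pvx , l<lx) (pvy , l<ly)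
  with ⟨ l , cy ⟩ <? mx
  where cy = atℕ (t (lOf (take my y))) l
... | yes end-y<mx = rows-clash {x} {y} l agree differ
        (λ p lp<mx → prefix-row l p mx≤x pvx l<lx lp<mx)
        (λ p lp<mx → prefix-row l p my≤y pvy l<ly (<-≤-trans lp<mx mx≤my))
        (<-trans (n<1+n _) (prefix-row-end l mx≤x pvx l<lx)) end-y<mx
  where mx≤x = <⇒≤ (Longest.proper M)
... | no end-y≮mx = <⇒≱ (s≤s (≮⇒≥ end-y≮mx)) (Longest.longest M _ end-y<x (proj₁ extended))
  where
  cy = atℕ (t (lOf (take my y))) l
  mx≤x = <⇒≤ (Longest.proper M)
  end-y<x : suc ⟨ l , cy ⟩ < length x
  end-y<x = subst (suc ⟨ l , cy ⟩ <_) (sym |x|≡|y|) (<-≤-trans (prefix-row-end l my≤y pvy l<ly) my≤y)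
  cy>0 : 0 < cy
  cy>0 = n≢0⇒n>0 (λ cy≡0 → end-y≮mx (subst (λ c → ⟨ l , c ⟩ < mx) (sym cy≡0)
           (≤-<-trans (pair-row-start l _) (<-trans (n<1+n _) (prefix-row-end l mx≤x pvx l<lx)))))
  x-ends-in-1 : at x ⟨ l , cy ⟩ ≡ true
  x-ends-in-1 = trans (agree _ (row-start≢ l cy>0))
    (trans (prefix-row l cy my≤y pvy l<ly (<-trans (n<1+n _) (prefix-row-end l my≤y pvy l<ly))) (s10∞-at-n cy))
  extended : LPlaced l (take (suc ⟨ l , cy ⟩) x)
  extended = prefix-placed cy px lx (<-trans (n<1+n _) end-y<x) (λ _ → x-ends-in-1)

-- If u is l-placed and longer than ⟨l,0⟩ + 1 and u^- is (> l)-placed, then (u^l)^- is l-placed: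
-- it is not (< l)-placed by longest-not-lower, and not (> l)-placed by no-two-higher applied
-- with the shorter of the two prefixes first.
longest-flip-of-higher : ∀ {w l m m′} → Placed w → lOf w ≡ l → suc ⟨ l , 0 ⟩ < length w →
  Longest Placed w m → Longest Placed (flipAt w ⟨ l , 0 ⟩) m′ →
  GtPlaced l (take m w) → LPlaced l (take m′ (flipAt w ⟨ l , 0 ⟩))
longest-flip-of-higher {w} {l} {m} {m′} pw lw long M M′ higher = classify (<-cmp (lOf (take m′ w′)) l)
  where
  n₀ = ⟨ l , 0 ⟩
  w′ = flipAt w n₀
  |w|≡|w′| : length w ≡ length w′
  |w|≡|w′| = sym (length-flip w n₀)
  pw′ : Placed w′
  pw′ = flip-placed l (≤-reflexive lw) pw
  lw′ : lOf w′ ≡ l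
  lw′ = trans (lOf-flip w n₀) lw
  agree : ∀ j → j ≢ n₀ → at w j ≡ at w′ j
  agree j j≢n₀ = sym (at-flip-other w n₀ j j≢n₀)
  differ : at w n₀ ≢ at w′ n₀
  differ = subst (at w n₀ ≢_) (sym (at-flip-here w n₀ (<-trans (n<1+n n₀) long))) (not-¬ refl)
  classify : Tri (lOf (take m′ w′) < l) (lOf (take m′ w′) ≡ l) (l < lOf (take m′ w′)) →
             LPlaced l (take m′ w′)
  classify (tri≈ _ same _) = Longest.holds M′ , same
  classify (tri< lower _ _) = ⊥-elim (longest-not-lower pw′ lw′ (subst (suc n₀ <_) |w|≡|w′| long) M′
                                        (Longest.holds M′ , lower))
  classify (tri> _ _ higher′) with ≤-total m m′
  ... | inj₁ m≤m′ = ⊥-elim (no-two-higher |w|≡|w′| agree differ pw lw M m≤m′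
                      (<⇒≤ (Longest.proper M′)) higher (Longest.holds M′ , higher′))
  ... | inj₂ m′≤m = ⊥-elim (no-two-higher (sym |w|≡|w′|) (λ j ne → sym (agree j ne)) (differ ∘ sym)
                      pw′ lw′ M′ m′≤m (<⇒≤ (Longest.proper M)) (Longest.holds M′ , higher′) higher)

long⇒2≤ : ∀ {k n} → suc k < n → 2 ≤ n
long⇒2≤ long = ≤-trans (s≤s (s≤s z≤n)) long

minus-flip-of-higher : ∀ {w l} → Placed w → lOf w ≡ l → suc ⟨ l , 0 ⟩ < length w →
  GtPlaced l (minus w) → LPlaced l (minus (flipAt w ⟨ l , 0 ⟩))
minus-flip-of-higher {w} {l} pw lw long higher = subst (LPlaced l) (sym (minus-is 2≤w′ M′))
  (longest-flip-of-higher pw lw long M M′ (subst (GtPlaced l) (minus-is 2≤w M) higher))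
  where
  w′ = flipAt w ⟨ l , 0 ⟩
  2≤w′ : 2 ≤ length w′
  2≤w′ = subst (2 ≤_) (sym (length-flip w _)) (long⇒2≤ long)
  M = proj₂ (minus-exists w (long⇒2≤ long))
  M′ = proj₂ (minus-exists w′ 2≤w′)
  2≤w = long⇒2≤ long

minus-not-lower : ∀ {w l} → Placed w → lOf w ≡ l → suc ⟨ l , 0 ⟩ < length w → ¬ LtPlaced l (minus w)
minus-not-lower {w} pw lw long lower =
  longest-not-lower pw lw long M (subst (LtPlaced _) (minus-is (long⇒2≤ long) M) lower)
  where M = proj₂ (minus-exists w (long⇒2≤ long))

module Flipped {u : List Bool} (pu : Placed u) (2≤u : 2 ≤ length u) where

  l = lOf u
  n₀ = ⟨ l , 0 ⟩
  u′ = sup u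

  pu′ : Placed u′
  pu′ = flip-placed l ≤-refl pu

  lu′ : lOf u′ ≡ l
  lu′ = lOf-flip u n₀

  2≤u′ : 2 ≤ length u′
  2≤u′ = subst (2 ≤_) (sym (length-flip u n₀)) 2≤u

  l-placed⇒≤ : ∀ {v} → LPlaced l v → LeqPlaced l v
  l-placed⇒≤ (pv , lv≡l) = pv , ≤-reflexive lv≡l

  part-a : LPlaced l (minus u) →
           ε (minus u) ≡ ε u × (LPlaced l (minus u′) → minus u′ ≡ sup (minus u))
  part-a low = ε-minus pu refl 2≤u low , λ low′ → begin
    minus u′                ≡⟨ sym (minusL-of-low-minus l u′ 2≤u′ (l-placed⇒≤ low′)) ⟩
    minusL l u′             ≡⟨ minusL-flip l u 2≤u ⟩
    flipAt (minusL l u) n₀  ≡⟨ cong (λ v → flipAt v n₀) (minusL-of-low-minus l u 2≤u (l-placed⇒≤ low)) ⟩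
    flipAt (minus u) n₀     ≡⟨ sym (sup-at (proj₂ low)) ⟩
    sup (minus u)           ∎
    where open ≡-Reasoning

  part-b : (LPlaced l (minusL l u) ⇔ LPlaced l (minusL l u′)) ×
           (LPlaced l (minusL l u) → ε (minusL l u) ≡ ε u × minusL l u′ ≡ sup (minusL l u))
  part-b = subst (λ v → LPlaced l (minusL l u) ⇔ LPlaced l v) (sym (minusL-flip l u 2≤u)) (flip-l-placed⇔ l) ,
           λ low → ε-minusL pu refl 2≤u low , trans (minusL-flip l u 2≤u) (sym (sup-at (proj₂ low)))

  long-or-short : suc n₀ < length u ⊎ suc n₀ ≡ length u
  long-or-short = m≤n⇒m<n∨m≡n (row-start-inside u pu)

  C-claim : Set
  C-claim = LtPlaced l (minus u) ⊎ LtPlaced l (minus u′) →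
            minus u ≡ minusL l u × minusL l u ≡ minus u′ × minus u′ ≡ minusL l u′

  D-claim : Set
  D-claim = (GtPlaced l (minus u) ⊎ GtPlaced l (minus u′) →
               (GtPlaced l (minus u) × LPlaced l (minus u′)) ⊎ (GtPlaced l (minus u′) × LPlaced l (minus u))) ×
            (GtPlaced l (minus u) → minusL l u ≡ sup (minus u′) × ε (minusL l u) ≡ ε u) ×
            (GtPlaced l (minus u′) → minusL l u ≡ minus u × ε (minusL l u′) ≡ ε u′)

  module Short (short : suc n₀ ≡ length u) where
    same-minus : minus u′ ≡ minus u
    same-minus = minus-flip-last u n₀ 2≤u (sym short)

    same-minusL : minusL l u′ ≡ minusL l u
    same-minusL = minusL-flip-last l u n₀ 2≤u (sym short)

    part-c : C-claim
    part-c lower = sym low-is-minusL , trans low-is-minusL (sym same-minus) ,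
                   trans same-minus (trans (sym low-is-minusL) (sym same-minusL))
      where
      lower-u : LtPlaced l (minus u)
      lower-u = [ id , subst (LtPlaced l) same-minus ]′ lower
      low-is-minusL : minusL l u ≡ minus u
      low-is-minusL = minusL-of-low-minus l u 2≤u (proj₁ lower-u , <⇒≤ (proj₂ lower-u))

    part-d : D-claim
    part-d = ⊥-elim ∘ [ not-higher , not-higher′ ]′ , ⊥-elim ∘ not-higher , ⊥-elim ∘ not-higher′
      where
      not-higher : ¬ GtPlaced l (minus u)
      not-higher = minus-not-higher-if-short {u} 2≤u (sym short)
      not-higher′ : ¬ GtPlaced l (minus u′)
      not-higher′ = not-higher ∘ subst (GtPlaced l) same-minus

  module Long (long : suc n₀ < length u) where
    long′ : suc n₀ < length u′
    long′ = subst (suc n₀ <_) (sym (length-flip u n₀)) long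

    back : flipAt u′ n₀ ≡ u
    back = flip-involutive u n₀

    other-of-higher : GtPlaced l (minus u) → LPlaced l (minus u′)
    other-of-higher = minus-flip-of-higher pu refl long

    other-of-higher′ : GtPlaced l (minus u′) → LPlaced l (minus u)
    other-of-higher′ higher′ = subst (λ w → LPlaced l (minus w)) back (minus-flip-of-higher pu′ lu′ long′ higher′)

    part-c : C-claim
    part-c = ⊥-elim ∘ [ minus-not-lower pu refl long , minus-not-lower pu′ lu′ long′ ]′

    part-d : D-claim
    part-d = [ (λ h → inj₁ (h , other-of-higher h)) , (λ h → inj₂ (h , other-of-higher′ h)) ]′ ,
             higher-u , higher-u′
      where
      higher-u : GtPlaced l (minus u) → minusL l u ≡ sup (minus u′) × ε (minusL l u) ≡ ε u
      higher-u higher = minusL-u , ε-minusL pu refl 2≤u (subst (LPlaced l) (sym minusL-u) sup-placed)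
        where
        low′ = other-of-higher higher
        sup-placed : LPlaced l (sup (minus u′))
        sup-placed = subst (LPlaced l) (sym (sup-at (proj₂ low′))) (Equivalence.to (flip-l-placed⇔ l) low′)
        minusL-u : minusL l u ≡ sup (minus u′)
        minusL-u = begin
          minusL l u              ≡⟨ sym (flip-involutive (minusL l u) n₀) ⟩
          flipAt (flipAt (minusL l u) n₀) n₀ ≡⟨ cong (λ v → flipAt v n₀) (sym (minusL-flip l u 2≤u)) ⟩
          flipAt (minusL l u′) n₀ ≡⟨ cong (λ v → flipAt v n₀) (minusL-of-low-minus l u′ 2≤u′ (l-placed⇒≤ low′)) ⟩
          flipAt (minus u′) n₀    ≡⟨ sym (sup-at (proj₂ low′)) ⟩
          sup (minus u′)          ∎
          where open ≡-Reasoning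
      higher-u′ : GtPlaced l (minus u′) → minusL l u ≡ minus u × ε (minusL l u′) ≡ ε u′
      higher-u′ higher′ = minusL-u , ε-minusL pu′ lu′ 2≤u′ (subst (LPlaced l) (sym minusL-u′) flip-placed′)
        where
        low = other-of-higher′ higher′
        minusL-u : minusL l u ≡ minus u
        minusL-u = minusL-of-low-minus l u 2≤u (l-placed⇒≤ low)
        minusL-u′ : minusL l u′ ≡ flipAt (minus u) n₀
        minusL-u′ = trans (minusL-flip l u 2≤u) (cong (λ v → flipAt v n₀) minusL-u)
        flip-placed′ : LPlaced l (flipAt (minus u) n₀)
        flip-placed′ = Equivalence.to (flip-l-placed⇔ l) low

  part-c : C-claim
  part-c = [ Long.part-c , Short.part-c ]′ long-or-short

  part-d : D-claim
  part-d = [ Long.part-d , Short.part-d ]′ long-or-short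

lemma4p10 : (l : ℕ) (u : List Bool) → LPlaced l u → 2 ≤ length u →
    -- (a)
    (LPlaced l (minus u) →
       ε (minus u) ≡ ε u ×
       (LPlaced l (minus (sup u)) → minus (sup u) ≡ sup (minus u)))
    ×
    -- (b)
    ((LPlaced l (minusL l u) ⇔ LPlaced l (minusL l (sup u))) ×
     (LPlaced l (minusL l u) →
        ε (minusL l u) ≡ ε u × minusL l (sup u) ≡ sup (minusL l u)))
    ×
    -- (c)
    (LtPlaced l (minus u) ⊎ LtPlaced l (minus (sup u)) →
       minus u ≡ minusL l u × minusL l u ≡ minus (sup u) ×
       minus (sup u) ≡ minusL l (sup u))
    ×
    -- (d)
    ((GtPlaced l (minus u) ⊎ GtPlaced l (minus (sup u)) →
       (GtPlaced l (minus u) × LPlaced l (minus (sup u))) ⊎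
       (GtPlaced l (minus (sup u)) × LPlaced l (minus u))) ×
     (GtPlaced l (minus u) →
       minusL l u ≡ sup (minus (sup u)) × ε (minusL l u) ≡ ε u) ×
     (GtPlaced l (minus (sup u)) →
       minusL l u ≡ minus u × ε (minusL l (sup u)) ≡ ε (sup u)))
lemma4p10 .(lOf u) u (pu , refl) 2≤u = part-a , part-b , part-c , part-d
  where open Flipped pu 2≤u
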